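{- Let $\mathcal{F}$ be a finite family of sets with levels $\mathcal{F}_1,\dots,\mathcal{F}_t$ and auxiliary graph $H=H(\mathcal{F})$ as defined in the context. Let $1\le i<i'\le t$ and let $X,Y\in\mathcal{F}$ be two sets of rank at most $i$ such that $X\cup Y\in\mathcal{F}_{i'}$. Then $(i,i')$ is an edge of $H$.
   Context: Let $\mathcal{F}$ be a finite nonempty family of sets, partially ordered by inclusion, and let $t$ be the maximum number of sets in a chain of $\mathcal{F}$. Define the levels: $\mathcal{F}_t$ is the family of maximal (by inclusion) sets in $\mathcal{F}$, and for $i=t-1,\dots,1$, $\mathcal{F}_i$ is the family of maximal sets in $\mathcal{F}\setminus\bigcup_{j=i+1}^t\mathcal{F}_j$. A set $X\in\mathcal{F}_i$ is said to have rank $i$. The auxiliary graph $H=H(\mathcal{F})$ has vertex set $\{1,\dots,t\}$, and for $i<i'$ the pair $(i,i')$ is an edge of $H$ if there exist two disjoint chains $\mathcal{X},\mathcal{Y}\subseteq\mathcal{F}$, each starting (smallest element) in $\mathcal{F}_i$ and ending (largest element) in $\mathcal{F}_{i'-1}$, such that (i) $\mathcal{X}$ and $\mathcal{Y}$ both have length (number of sets) $i'-i$, and (ii) at most one set in $\{X\cup Y : X\in\mathcal{X}, Y\in\mathcal{Y}\}$ has rank $i'$, and every other set of this form either has rank greater than $i'$ or does not belong to $\mathcal{F}$. -}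

module Defs where

open import Data.Nat using (ℕ; zero; suc; _≤_; _<_; _∸_)
open import Data.Fin using (Fin; toℕ)
open import Data.Fin.Subset using (Subset; _⊆_; _⊂_; _∪_)
open import Data.List using (List)
open import Data.List.Membership.Propositional using () renaming (_∈_ to _∈ₗ_)
open import Data.Product using (Σ; _×_; ∃-syntax)
open import Data.Sum using (_⊎_)
open import Relation.Nullary using (¬_)
open import Relation.Binary.PropositionalEquality using (_≡_; _≢_)

Family : ℕ → Set
Family n = List (Subset n)

IsChain : ∀ {n} → Family n → (m : ℕ) → (Fin m → Subset n) → Set
IsChain F m C = (∀ a → C a ∈ₗ F) × (∀ a b → toℕ a < toℕ b → C a ⊂ C b)

IsMaxChainLength : ∀ {n} → Family n → ℕ → Set
IsMaxChainLength {n} F t =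
  (Σ (Fin t → Subset n) λ C → IsChain F t C)
  × (∀ m (C : Fin m → Subset _) → IsChain F m C → m ≤ t)

Rem : ∀ {n} → Family n → ℕ → Subset n → Set
Top : ∀ {n} → Family n → ℕ → Subset n → Set
Rem F zero X = X ∈ₗ F
Rem F (suc k) X = Rem F k X × ¬ Top F k X
Top F k X = Rem F k X × (∀ Y → Rem F k Y → X ⊆ Y → X ≡ Y)

-- Level F_i = Top F (t ∸ i), for 1 ≤ i ≤ t (F_t = Top F 0, F_{t-1} = Top F 1, ...).
HasRank : ∀ {n} → Family n → (t i : ℕ) → Subset n → Set
HasRank F t i X = 1 ≤ i × i ≤ t × Top F (t ∸ i) X

IsEdgeH : ∀ {n} → Family n → (t i i' : ℕ) → Set
IsEdgeH {n} F t i i' =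
  i < i' ×
  Σ (Fin (i' ∸ i) → Subset n) λ C →
  Σ (Fin (i' ∸ i) → Subset n) λ D →
    IsChain F (i' ∸ i) C × IsChain F (i' ∸ i) D
    × (∀ a b → C a ≢ D b)
    × (∀ a → toℕ a ≡ 0 → HasRank F t i (C a) × HasRank F t i (D a))
    × (∀ a → suc (toℕ a) ≡ i' ∸ i →
         HasRank F t (i' ∸ 1) (C a) × HasRank F t (i' ∸ 1) (D a))
    × (∀ a b a' b' → HasRank F t i' (C a ∪ D b) → HasRank F t i' (C a' ∪ D b')
         → C a ∪ D b ≡ C a' ∪ D b')
    × (∀ a b → HasRank F t i' (C a ∪ D b)
         ⊎ (∃[ j ] (i' < j × HasRank F t j (C a ∪ D b)))
         ⊎ ¬ (C a ∪ D b ∈ₗ F))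

-- Enlarge X and Y to sets X', Y' of rank exactly i, and from each climb a chain
-- X' = C₀ ⊂ C₁ ⊂ … of sets of consecutive ranks i, i+1, …, i'-1 (every set of
-- rank r < t lies strictly below a set of rank r+1). Every union C_a ∪ D_b contains
-- X ∪ Y, which has rank i', and rank can only grow along inclusions; so such a union,
-- if it lies in F, has rank i' — and then equals X ∪ Y by maximality — or larger.
-- A common member C_a = D_b would contain X ∪ Y while having rank below i', so the
-- two chains are disjoint.
module Submission where

open import Defs
open import Data.Nat using (ℕ; _≤_; _<_)
open import Data.Fin.Subset using (Subset; _∪_)
open import Data.List.Membership.Propositional using () renaming (_∈_ to _∈ₗ_)
open import Data.Product using (_×_; ∃-syntax)

open import Data.Bool.Properties using () renaming (_≟_ to _≟ᵇ_)
open import Data.Nat using (zero; suc; _+_; _∸_; z≤n; s≤s; s≤s⁻¹; _≤′_; ≤′-refl; ≤′-step)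
open import Data.Nat.Properties hiding (_≟_)
open import Data.Fin using (Fin; toℕ)
open import Data.Fin.Properties using (toℕ<n)
open import Data.Fin.Subset using (_⊆_; _⊂_; _⊃_)
open import Data.Fin.Subset.Properties
  using (_∈?_; _⊂?_; ⊆-refl; ⊆-trans; ⊆-antisym; ⊂-trans; ⊂-⊆-trans; ⊂-irref; p⊆p∪q; q⊆p∪q; x∈p∪q⁻)
open import Data.Fin.Subset.Induction using (⊃-wellFounded; Acc; acc)
open import Data.List.Relation.Unary.Any using (any?; satisfied)
open import Data.List.Membership.Propositional using (lose)
import Data.List.Membership.DecPropositional as DecMembership
open import Data.Product using (∃; _,_; proj₁; proj₂; map₁; map₂)
open import Data.Sum using (_⊎_; inj₁; inj₂; [_,_]′)
import Data.Sum as Sum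
open import Data.Vec.Properties using (≡-dec)
open import Function using (_∘_)
open import Relation.Binary using (Rel; Transitive)
open import Relation.Binary.PropositionalEquality
  using (_≡_; _≢_; refl; sym; trans; cong; subst; module ≡-Reasoning)
open import Relation.Nullary using (¬_; yes; no; contradiction)
open import Relation.Nullary.Decidable using (_×-dec_; ¬?; decidable-stable)
open import Relation.Unary using (Decidable)

module _ {a ℓ} {A : Set a} {_≺_ : Rel A ℓ} (≺-trans : Transitive _≺_)
         {m : ℕ} {c : ℕ → A} (step : ∀ {s} → s < m → c s ≺ c (suc s)) where

  stepwise⇒monotone : ∀ {r s} → r < s → s ≤ m → c r ≺ c s
  stepwise⇒monotone {s = suc s} (s≤s r≤s) s<m with m≤n⇒m<n∨m≡n r≤s
  ... | inj₁ r<s = ≺-trans (stepwise⇒monotone r<s (<⇒≤ s<m)) (step s<m)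
  ... | inj₂ refl = step s<m

∸-split : ∀ {m n o} → m ≤ n → n ≤ o → o ∸ m ≡ (n ∸ m) + (o ∸ n)
∸-split {m} {n} {o} m≤n n≤o = begin
  o ∸ m               ≡⟨ cong (_∸ m) (sym (m∸n+n≡m n≤o)) ⟩
  (o ∸ n + n) ∸ m     ≡⟨ +-∸-assoc (o ∸ n) m≤n ⟩
  (o ∸ n) + (n ∸ m)   ≡⟨ +-comm (o ∸ n) (n ∸ m) ⟩
  (n ∸ m) + (o ∸ n)   ∎
  where open ≡-Reasoning

module _ {n : ℕ} where

  ⊆⇒≡⊎⊂ : {X Y : Subset n} → X ⊆ Y → X ≡ Y ⊎ X ⊂ Y
  ⊆⇒≡⊎⊂ {X} {Y} X⊆Y with X ⊂? Y
  ... | yes X⊂Y = inj₂ X⊂Y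
  ... | no X⊄Y = inj₁ (⊆-antisym X⊆Y Y⊆X)
    where
    Y⊆X : Y ⊆ X
    Y⊆X {x} x∈Y = decidable-stable (x ∈? X) (λ x∉X → X⊄Y (X⊆Y , x , x∈Y , x∉X))

  ∪-least : {A B C : Subset n} → A ⊆ C → B ⊆ C → A ∪ B ⊆ C
  ∪-least {A} {B} A⊆C B⊆C x∈A∪B = [ A⊆C , B⊆C ]′ (x∈p∪q⁻ A B x∈A∪B)

  ∪-mono : {A B A' B' : Subset n} → A ⊆ A' → B ⊆ B' → A ∪ B ⊆ A' ∪ B'
  ∪-mono {A' = A'} {B'} A⊆A' B⊆B' = ∪-least (⊆-trans A⊆A' (p⊆p∪q B')) (⊆-trans B⊆B' (q⊆p∪q A' B'))

module Peeling {n : ℕ} (F : Family n) where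

  ∈F? : Decidable (_∈ₗ F)
  ∈F? X = DecMembership._∈?_ (≡-dec _≟ᵇ_) X F

  Rem-antitone : ∀ {k l X} → k ≤ l → Rem F l X → Rem F k X
  Rem-antitone = go ∘ ≤⇒≤′
    where
    go : ∀ {k l X} → k ≤′ l → Rem F l X → Rem F k X
    go ≤′-refl rem = rem
    go (≤′-step k≤′l) rem = go k≤′l (proj₁ rem)

  Rem⇒∈ : ∀ {k X} → Rem F k X → X ∈ₗ F
  Rem⇒∈ = Rem-antitone z≤n

  Top⇒∈ : ∀ {k X} → Top F k X → X ∈ₗ F
  Top⇒∈ = Rem⇒∈ ∘ proj₁

  Top-⊆⇒≡ : ∀ {k Z W} → Z ⊆ W → Top F k Z → Top F k W → Z ≡ W
  Top-⊆⇒≡ {W = W} Z⊆W topZ topW = proj₂ topZ W (proj₁ topW) Z⊆W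

  Rem? : ∀ k → Decidable (Rem F k)
  Top? : ∀ k → Decidable (Top F k)
  Top⊎⊂Rem : ∀ {k X} → Rem F k X → Top F k X ⊎ ∃[ Y ] (Rem F k Y × X ⊂ Y)

  Rem? zero      = ∈F?
  Rem? (suc k) X = Rem? k X ×-dec ¬? (Top? k X)

  Top? k X with Rem? k X
  ... | no ¬rem = no (¬rem ∘ proj₁)
  ... | yes rem with Top⊎⊂Rem rem
  ...   | inj₁ top = yes top
  ...   | inj₂ (Y , remY , X⊂Y) = no λ top → ⊂-irref (proj₂ top Y remY (proj₁ X⊂Y)) X⊂Y

  Top⊎⊂Rem {k} {X} rem with any? (λ Y → Rem? k Y ×-dec X ⊂? Y) F
  ... | yes found = inj₂ (satisfied found)
  ... | no none = inj₁ (rem , maximal)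
    where
    maximal : ∀ Y → Rem F k Y → X ⊆ Y → X ≡ Y
    maximal Y remY X⊆Y with ⊆⇒≡⊎⊂ X⊆Y
    ... | inj₁ X≡Y = X≡Y
    ... | inj₂ X⊂Y = contradiction (lose (Rem⇒∈ remY) (remY , X⊂Y)) none

  Rem⇒⊆Top : ∀ {k X} → Rem F k X → ∃[ W ] (Top F k W × X ⊆ W)
  Rem⇒⊆Top rem = go rem (⊃-wellFounded _)
    where
    go : ∀ {k X} → Rem F k X → Acc _⊃_ X → ∃[ W ] (Top F k W × X ⊆ W)
    go rem (acc larger) with Top⊎⊂Rem rem
    ... | inj₁ top = _ , top , ⊆-refl
    ... | inj₂ (Y , remY , X⊂Y) = map₂ (map₂ (⊆-trans (proj₁ X⊂Y))) (go remY (larger X⊂Y))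

  Top-lift : ∀ {k l X} → k ≤ l → Top F l X → ∃[ W ] (Top F k W × X ⊆ W)
  Top-lift k≤l = Rem⇒⊆Top ∘ Rem-antitone k≤l ∘ proj₁

  Top-step : ∀ {l X} → Top F (suc l) X → ∃[ W ] (Top F l W × X ⊂ W)
  Top-step ((rem , ¬top) , _) with Top⊎⊂Rem rem
  ... | inj₁ top = contradiction top ¬top
  ... | inj₂ (Y , remY , X⊂Y) = map₂ (map₂ (⊂-⊆-trans X⊂Y)) (Rem⇒⊆Top remY)

  -- If W were peeled after Z, it would still be present when Z is peeled, and the
  -- maximality of Z would force Z = W.
  Top-antitone : ∀ {k l Z W} → Z ⊆ W → Top F k Z → Top F l W → l ≤ k
  Top-antitone {k} {l} {W = W} Z⊆W topZ (remW , _) with l ≤? k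
  ... | yes l≤k = l≤k
  ... | no l≰k with Rem-antitone (≰⇒> l≰k) remW
  ...   | remₖW , ¬topW = contradiction (subst (Top F k) (proj₂ topZ W remₖW Z⊆W) topZ) ¬topW

  ∈⇒Top-below : ∀ {X} l → X ∈ₗ F → ¬ Rem F l X → ∃[ k ] (k < l × Top F k X)
  ∈⇒Top-below zero X∈F ¬rem = contradiction X∈F ¬rem
  ∈⇒Top-below {X} (suc l) X∈F ¬rem with Rem? l X | Top? l X
  ... | yes _   | yes top = l , ≤-refl , top
  ... | yes rem | no ¬top = contradiction (rem , ¬top) ¬rem
  ... | no ¬remₗ | _      = map₂ (map₁ m<n⇒m<1+n) (∈⇒Top-below l X∈F ¬remₗ)

  -- ascent m top s has depth m + l ∸ s for s ≤ m, and stays at the depth-l set beyond.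
  ascent : ∀ m {l W} → Top F (m + l) W → ℕ → Subset n
  ascent zero    {W = W} _ _ = W
  ascent (suc m) {W = W} _ zero = W
  ascent (suc m) top (suc s) = ascent m (proj₁ (proj₂ (Top-step top))) s

  ascent-0 : ∀ m {l W} (top : Top F (m + l) W) → ascent m top 0 ≡ W
  ascent-0 zero    _ = refl
  ascent-0 (suc m) _ = refl

  ascent-∈ : ∀ m {l W} (top : Top F (m + l) W) s → ascent m top s ∈ₗ F
  ascent-∈ zero    top _       = Top⇒∈ top
  ascent-∈ (suc m) top zero    = Top⇒∈ top
  ascent-∈ (suc m) top (suc s) = ascent-∈ m _ s

  ascent-top : ∀ m {l W} (top : Top F (m + l) W) → Top F l (ascent m top m)
  ascent-top zero    top = top
  ascent-top (suc m) top = ascent-top m _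

  ascent-step : ∀ m {l W} (top : Top F (m + l) W) {s} → s < m →
    ascent m top s ⊂ ascent m top (suc s)
  ascent-step (suc m) {W = W} top {zero} _ =
    subst (W ⊂_) (sym (ascent-0 m _)) (proj₂ (proj₂ (Top-step top)))
  ascent-step (suc m) top {suc s} (s≤s s<m) = ascent-step m _ s<m

  ascent-⊂ : ∀ m {l W} (top : Top F (m + l) W) {r s} → r < s → s ≤ m →
    ascent m top r ⊂ ascent m top s
  ascent-⊂ m top = stepwise⇒monotone {_≺_ = _⊂_} ⊂-trans {c = ascent m top} (ascent-step m top)

  ascent-⊆ : ∀ m {l W} (top : Top F (m + l) W) {r s} → r ≤ s → s ≤ m →
    ascent m top r ⊆ ascent m top s
  ascent-⊆ m top r≤s s≤m with m≤n⇒m<n∨m≡n r≤s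
  ... | inj₁ r<s = proj₁ (ascent-⊂ m top r<s s≤m)
  ... | inj₂ refl = ⊆-refl

  ascent-IsChain : ∀ m {l W} (top : Top F (m + l) W) {k} → k ≤ suc m →
    IsChain F k (ascent m top ∘ toℕ)
  ascent-IsChain m top k≤1+m =
    (ascent-∈ m top ∘ toℕ) , λ a b a<b → ascent-⊂ m top a<b (s≤s⁻¹ (≤-trans (toℕ<n b) k≤1+m))

  Rem⇒IsChain : ∀ {k X} → Rem F k X → ∃ (IsChain F (suc k))
  Rem⇒IsChain {k} rem =
    let (W , top , _) = Rem⇒⊆Top rem
    in _ , ascent-IsChain k (subst (λ e → Top F e W) (sym (+-identityʳ k)) top) ≤-refl

  raise-rank : ∀ {t i j X} → 1 ≤ i → i ≤ t → j ≤ i → HasRank F t j X →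
    ∃[ W ] (HasRank F t i W × X ⊆ W)
  raise-rank {t} 1≤i i≤t j≤i (_ , _ , topX) =
    let (W , topW , X⊆W) = Top-lift (∸-monoʳ-≤ t j≤i) topX in W , (1≤i , i≤t , topW) , X⊆W

module _ {n : ℕ} {F : Family n} {t : ℕ} (mc : IsMaxChainLength F t) where
  open Peeling F

  ¬Rem-t : ∀ {X} → ¬ Rem F t X
  ¬Rem-t rem = let (C , chain) = Rem⇒IsChain rem in n≮n t (proj₂ mc (suc t) C chain)

  ∈⇒Top : ∀ {X} → X ∈ₗ F → ∃[ k ] (k < t × Top F k X)
  ∈⇒Top X∈F = ∈⇒Top-below t X∈F ¬Rem-t

  HasRank-⊆ : ∀ {r Z U} → Z ⊆ U → U ∈ₗ F → HasRank F t r Z →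
    HasRank F t r U ⊎ ∃[ r' ] (r < r' × HasRank F t r' U)
  HasRank-⊆ {r} {U = U} Z⊆U U∈F (1≤r , r≤t , topZ) with ∈⇒Top U∈F
  ... | k , k<t , topU with m≤n⇒m<n∨m≡n (Top-antitone Z⊆U topZ topU)
  ...   | inj₂ refl = inj₁ (1≤r , r≤t , topU)
  ...   | inj₁ k<t∸r = inj₂ (t ∸ k , ∸-cancelʳ-< (subst (_< t ∸ r) (sym t∸[t∸k]≡k) k<t∸r) ,
                          m<n⇒0<n∸m k<t , m∸n≤m t k , subst (λ e → Top F e U) (sym t∸[t∸k]≡k) topU)
    where
    t∸[t∸k]≡k : t ∸ (t ∸ k) ≡ k
    t∸[t∸k]≡k = m∸[m∸n]≡n (<⇒≤ k<t)

  HasRank⇒IsEdgeH : ∀ {i i' X Y Z} → i < i' → HasRank F t i X → HasRank F t i Y →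
    HasRank F t i' Z → Z ⊆ X ∪ Y → IsEdgeH F t i i'
  HasRank⇒IsEdgeH {i} {suc i''} {X} {Y} {Z}
    (s≤s i≤i'') rankX rankY rankZ@(_ , i'≤t , topZ) Z⊆X∪Y =
    s≤s i≤i'' , C , D , isChain rankX , isChain rankY , disjoint , first , last , unique , others
    where
    m : ℕ
    m = i'' ∸ i

    length : suc i'' ∸ i ≡ suc m
    length = +-∸-assoc 1 i≤i''

    bounded : (a : Fin (suc i'' ∸ i)) → toℕ a ≤ m
    bounded a = s≤s⁻¹ (subst (toℕ a <_) length (toℕ<n a))

    start : ∀ {W} → HasRank F t i W → Top F (m + (t ∸ i'')) W
    start {W} (_ , _ , topW) =
      subst (λ e → Top F e W) (∸-split i≤i'' (≤-trans (n≤1+n i'') i'≤t)) topW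

    chain : ∀ {W} → HasRank F t i W → Fin (suc i'' ∸ i) → Subset n
    chain rankW = ascent m (start rankW) ∘ toℕ

    isChain : ∀ {W} (rankW : HasRank F t i W) → IsChain F (suc i'' ∸ i) (chain rankW)
    isChain rankW = ascent-IsChain m (start rankW) (≤-reflexive length)

    base⊆chain : ∀ {W} (rankW : HasRank F t i W) a → W ⊆ chain rankW a
    base⊆chain rankW a =
      subst (_⊆ chain rankW a) (ascent-0 m (start rankW)) (ascent-⊆ m (start rankW) z≤n (bounded a))

    C D : Fin (suc i'' ∸ i) → Subset n
    C = chain rankX
    D = chain rankY

    Z⊆C∪D : ∀ a b → Z ⊆ C a ∪ D b
    Z⊆C∪D a b = ⊆-trans Z⊆X∪Y (∪-mono (base⊆chain rankX a) (base⊆chain rankY b))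

    disjoint : ∀ a b → C a ≢ D b
    disjoint a b Ca≡Db = n≮n (t ∸ suc i'') (Top-antitone Z⊆end topZ topEnd)
      where
      topEnd : Top F (suc (t ∸ suc i'')) (ascent m (start rankX) m)
      topEnd = subst (λ e → Top F e (ascent m (start rankX) m))
        (+-∸-assoc 1 i'≤t) (ascent-top m (start rankX))
      C∪D⊆C : C a ∪ D b ⊆ C a
      C∪D⊆C = ∪-least ⊆-refl (subst (_⊆ C a) Ca≡Db ⊆-refl)
      Z⊆end : Z ⊆ ascent m (start rankX) m
      Z⊆end = ⊆-trans (Z⊆C∪D a b) (⊆-trans C∪D⊆C (ascent-⊆ m (start rankX) (bounded a) ≤-refl))

    first : ∀ a → toℕ a ≡ 0 → HasRank F t i (C a) × HasRank F t i (D a)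
    first a a≡0 rewrite a≡0 | ascent-0 m (start rankX) | ascent-0 m (start rankY) = rankX , rankY

    last : ∀ a → suc (toℕ a) ≡ suc i'' ∸ i → HasRank F t i'' (C a) × HasRank F t i'' (D a)
    last a a≡m rewrite suc-injective (trans a≡m length) =
      (1≤i'' , i''≤t , ascent-top m (start rankX)) , (1≤i'' , i''≤t , ascent-top m (start rankY))
      where
      1≤i'' : 1 ≤ i''
      1≤i'' = ≤-trans (proj₁ rankX) i≤i''
      i''≤t : i'' ≤ t
      i''≤t = ≤-trans (n≤1+n i'') i'≤t

    unique : ∀ a b a' b' → HasRank F t (suc i'') (C a ∪ D b) →
      HasRank F t (suc i'') (C a' ∪ D b') → C a ∪ D b ≡ C a' ∪ D b'
    unique a b a' b' (_ , _ , top) (_ , _ , top') =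
      trans (sym (Top-⊆⇒≡ (Z⊆C∪D a b) topZ top)) (Top-⊆⇒≡ (Z⊆C∪D a' b') topZ top')

    others : ∀ a b → HasRank F t (suc i'') (C a ∪ D b)
      ⊎ (∃[ j ] (suc i'' < j × HasRank F t j (C a ∪ D b))) ⊎ ¬ (C a ∪ D b ∈ₗ F)
    others a b with ∈F? (C a ∪ D b)
    ... | yes ∈F = Sum.map₂ inj₁ (HasRank-⊆ (Z⊆C∪D a b) ∈F rankZ)
    ... | no ∉F = inj₂ (inj₂ ∉F)

lemma1 : ∀ {n} (F : Family n) (t : ℕ) → IsMaxChainLength F t →
    ∀ (i i' : ℕ) → 1 ≤ i → i < i' → i' ≤ t →
    ∀ (X Y : Subset n) → X ∈ₗ F → Y ∈ₗ F →
    (∃[ j ] (j ≤ i × HasRank F t j X)) →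
    (∃[ k ] (k ≤ i × HasRank F t k Y)) →
    HasRank F t i' (X ∪ Y) →
    IsEdgeH F t i i'
lemma1 F t mc i i' 1≤i i<i' i'≤t X Y _ _ (j , j≤i , rankX) (k , k≤i , rankY) rankX∪Y =
  let (X' , rankX' , X⊆X') = raise-rank 1≤i i≤t j≤i rankX
      (Y' , rankY' , Y⊆Y') = raise-rank 1≤i i≤t k≤i rankY
  in HasRank⇒IsEdgeH mc i<i' rankX' rankY' rankX∪Y (∪-mono X⊆X' Y⊆Y')
  where
  open Peeling F
  i≤t : i ≤ t
  i≤t = ≤-trans (<⇒≤ i<i') i'≤t
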